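{- For a propositional variable $p$, the formula $[\bullet p]\neg\bullet p$ is provable in $\mathbf{K}^{\bullet[\cdot]}$.
   Context: Fix a nonempty set $\mathbf{P}$ of propositional variables. Formulas: $\varphi::=p\mid\neg\varphi\mid\varphi\land\varphi\mid\bullet\varphi\mid[\varphi]\varphi$ ($p\in\mathbf{P}$), with $\circ\varphi:=\neg\bullet\varphi$. The system $\mathbf{K}^{\bullet[\cdot]}$ has axioms: A0 all propositional tautologies; A1 $\bullet\varphi\to\varphi$; A3 $\bullet(\psi\to\varphi)\land\varphi\to\bullet\varphi$; A5 $\bullet(\varphi\land\psi)\to\bullet\varphi\vee\bullet\psi$; AP $[\psi]p\leftrightarrow(\psi\to p)$; AN $[\psi]\neg\varphi\leftrightarrow(\psi\to\neg[\psi]\varphi)$; AC $[\psi](\varphi\land\chi)\leftrightarrow([\psi]\varphi\land[\psi]\chi)$; AA $[\psi][\chi]\varphi\leftrightarrow[\psi\land[\psi]\chi]\varphi$; A$\bullet$ $[\psi]\bullet\varphi\leftrightarrow(\psi\to\bullet[\psi]\varphi)$; and rules: from $\varphi$ infer $\circ\varphi$; from $\varphi\leftrightarrow\psi$ infer $\circ\varphi\leftrightarrow\circ\psi$; modus ponens. -}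

module Defs where

open import Data.Bool using (Bool; true; false; not; _∧_)

data Form (P : Set) : Set where
  var  : P → Form P
  ¬'_  : Form P → Form P
  _∧'_ : Form P → Form P → Form P
  •_   : Form P → Form P
  [_]_ : Form P → Form P → Form P

infixr 6 _∧'_
infix 7 ¬'_
infix 8 •_

module _ {P : Set} where
  _∨'_ : Form P → Form P → Form P
  φ ∨' ψ = ¬' (¬' φ ∧' ¬' ψ)

  _⇒_ : Form P → Form P → Form P
  φ ⇒ ψ = ¬' (φ ∧' ¬' ψ)

  _⇔_ : Form P → Form P → Form P
  φ ⇔ ψ = (φ ⇒ ψ) ∧' (ψ ⇒ φ)

  ∘_ : Form P → Form P
  ∘ φ = ¬' (• φ)

  infixr 5 _∨'_
  infixr 4 _⇒_
  infix 3 _⇔_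

  -- Propositional tautologies: formulas true under every Boolean assignment
  -- to their "propositional atoms", i.e. the maximal subformulas not
  -- headed by ¬ or ∧ (variables, •-formulas and [·]-formulas).
  eval : (Form P → Bool) → Form P → Bool
  eval v (¬' φ)    = not (eval v φ)
  eval v (φ ∧' ψ)  = eval v φ ∧ eval v ψ
  eval v φ@(var _) = v φ
  eval v φ@(• _)   = v φ
  eval v φ@([ _ ] _) = v φ

  Tautology : Form P → Set
  Tautology φ = (v : Form P → Bool) → eval v φ ≡ true
    where open import Relation.Binary.PropositionalEquality using (_≡_)

  data ⊢_ : Form P → Set where
    A0  : ∀ {φ} → Tautology φ → ⊢ φ
    A1  : ∀ {φ} → ⊢ (• φ ⇒ φ)
    A3  : ∀ {φ ψ} → ⊢ (• (ψ ⇒ φ) ∧' φ ⇒ • φ)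
    A5  : ∀ {φ ψ} → ⊢ (• (φ ∧' ψ) ⇒ • φ ∨' • ψ)
    AP  : ∀ {ψ p} → ⊢ ([ ψ ] var p ⇔ (ψ ⇒ var p))
    AN  : ∀ {ψ φ} → ⊢ ([ ψ ] (¬' φ) ⇔ (ψ ⇒ ¬' ([ ψ ] φ)))
    AC  : ∀ {ψ φ χ} → ⊢ ([ ψ ] (φ ∧' χ) ⇔ ([ ψ ] φ ∧' [ ψ ] χ))
    AA  : ∀ {ψ χ φ} → ⊢ ([ ψ ] ([ χ ] φ) ⇔ [ ψ ∧' [ ψ ] χ ] φ)
    A•  : ∀ {ψ φ} → ⊢ ([ ψ ] (• φ) ⇔ (ψ ⇒ • ([ ψ ] φ)))
    NEC : ∀ {φ} → ⊢ φ → ⊢ (∘ φ)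
    RE  : ∀ {φ ψ} → ⊢ (φ ⇔ ψ) → ⊢ (∘ φ ⇔ ∘ ψ)
    MP  : ∀ {φ ψ} → ⊢ (φ ⇒ ψ) → ⊢ φ → ⊢ ψ

  infix 2 ⊢_

{-# OPTIONS --safe #-}
-- Since •p → p (A1), the announcement of •p makes p true: ⊢ [•p]p, and by
-- necessitation ⊢ ∘[•p]p. Reducing [•p]¬•p with AN and A• turns it into
-- •p → ¬(•p → •[•p]p), which follows from ∘[•p]p propositionally.
module Submission where

open import Data.Bool using (true; false)
open import Relation.Binary.PropositionalEquality using (refl)
open import Defs

module _ {P : Set} where

  ⇔-elimʳ : {φ ψ : Form P} → ⊢ (φ ⇔ ψ) → ⊢ ψ → ⊢ φ
  ⇔-elimʳ {φ} {ψ} φ⇔ψ ⊢ψ = MP (MP (A0 taut) φ⇔ψ) ⊢ψ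
    where
    taut : Tautology ((φ ⇔ ψ) ⇒ ψ ⇒ φ)
    taut v with eval v φ | eval v ψ
    ... | true  | true  = refl
    ... | true  | false = refl
    ... | false | true  = refl
    ... | false | false = refl

  ⇒-¬-of-⇔-⇒ : {ψ χ ζ : Form P} → ⊢ (χ ⇔ (ψ ⇒ ζ)) → ⊢ (¬' ζ) → ⊢ (ψ ⇒ ¬' χ)
  ⇒-¬-of-⇔-⇒ {ψ} {χ} {ζ} χ⇔ψ⇒ζ ⊢¬ζ = MP (MP (A0 taut) χ⇔ψ⇒ζ) ⊢¬ζ
    where
    taut : Tautology ((χ ⇔ (ψ ⇒ ζ)) ⇒ ¬' ζ ⇒ ψ ⇒ ¬' χ)
    taut v with eval v ψ | eval v χ | eval v ζ
    ... | true  | true  | true  = refl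
    ... | true  | true  | false = refl
    ... | true  | false | true  = refl
    ... | true  | false | false = refl
    ... | false | true  | true  = refl
    ... | false | true  | false = refl
    ... | false | false | true  = refl
    ... | false | false | false = refl

  announce-var : {ψ : Form P} {p : P} → ⊢ (ψ ⇒ var p) → ⊢ ([ ψ ] var p)
  announce-var = ⇔-elimʳ AP

  announce-∘ : {ψ φ : Form P} → ⊢ (∘ ([ ψ ] φ)) → ⊢ ([ ψ ] (∘ φ))
  announce-∘ ⊢∘[ψ]φ = ⇔-elimʳ AN (⇒-¬-of-⇔-⇒ A• ⊢∘[ψ]φ)

mainTheorem17 : {P : Set} (p : P) → ⊢ ([ • var p ] (¬' (• var p)))
mainTheorem17 p = announce-∘ (NEC (announce-var A1))
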